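{- Let $n$ be a natural number and let $R(n)$ be the set of all tuples obtainable from the one-term tuple $(n)$ by a (possibly empty) non-ascending sequence of jumps. Then $R(n)$ consists exactly of all the partitions of $n$: every partition of $n$ is represented by a tuple in $R(n)$, and no partition of $n$ is represented by two different tuples of $R(n)$ (i.e. the map sending a tuple to the multiset of its terms is a bijection from $R(n)$ onto the set of partitions of $n$).
   Context: Partitions are written as finite ordered tuples of positive integers (the "terms"). For an integer $r\ge 1$, a jump of order $r$ transforms a tuple $(a_1,a_2,\dots,a_m)$ with $a_1>r$ into $(a_1-r,\,r,\,a_2,\dots,a_m)$; it is allowed only when the new first term $a_1-r$ is not less than the last term of the resulting tuple (which is $a_m$ if $m\ge 2$, and $r$ if $m=1$), and $r$ is not greater than any of the terms $a_2,\dots,a_m$ to its right. A non-ascending sequence of jumps is a finite sequence of successively applied jumps whose orders never increase. A partition of $n$ is a multiset of positive integers summing to $n$. -}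

module Defs where

open import Data.Nat using (ℕ; zero; suc; _≤_; _<_; _≥_; _∸_)
open import Data.List using (List; []; _∷_; [_])
open import Data.List.Relation.Unary.All using (All)
open import Data.List.Relation.Unary.Linked using (Linked)
open import Data.Product using (∃; _×_)

lastOf : ℕ → List ℕ → ℕ
lastOf x []       = x
lastOf x (y ∷ ys) = lastOf y ys

data Jump (r : ℕ) : List ℕ → List ℕ → Set where
  jump : ∀ a as → 1 ≤ r → r < a → All (r ≤_) as →
         lastOf r as ≤ a ∸ r →
         Jump r (a ∷ as) ((a ∸ r) ∷ r ∷ as)

data JumpSeq : List ℕ → List ℕ → List ℕ → Set where
  done : ∀ {t} → JumpSeq [] t t
  step : ∀ {r rs t u v} → Jump r t u → JumpSeq rs u v → JumpSeq (r ∷ rs) t v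

NonAscending : List ℕ → Set
NonAscending = Linked _≥_

InR : ℕ → List ℕ → Set
InR n t = ∃ λ rs → NonAscending rs × JumpSeq rs [ n ] t

{-# OPTIONS --safe #-}
-- A tuple reachable from (n) always has its maximum in front, followed by the remaining
-- terms in ascending order; equivalently, moving its head to the end yields a sorted list.
-- This is preserved by a jump of order r: r is put in front of terms that are all ≥ r,
-- and the new head a - r is at least the last (largest) term.  Such a tuple is determined
-- by its multiset, which gives uniqueness.  Conversely the tuple (m, y₁ ≤ … ≤ yₖ) with
-- m ≥ yₖ is reached from (m + Σ yᵢ) by splitting off yₖ, then yₖ₋₁, …, then y₁: a
-- non-ascending sequence of jumps.
module Submission where

open import Defs
open import Data.Nat using (ℕ; _≤_; _+_; _∸_)
open import Data.Nat.Properties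
  using (≤-refl; ≤-trans; ≤-totalOrder; ≤-decTotalOrder; +-identityʳ; +-assoc;
         m≤m+n; +-monoˡ-≤; m+n∸n≡m; m∸n+n≡m; m<n⇒0<n∸m; <⇒≤)
open import Data.Nat.ListAction using (sum)
open import Data.List using (List; []; _∷_; [_]; _∷ʳ_; initLast; _∷ʳ′_)
open import Data.List.Properties using (∷ʳ-injective)
open import Data.List.Membership.Propositional using (_∈_)
open import Data.List.Relation.Unary.All as All using (All; []; _∷_)
open import Data.List.Relation.Unary.All.Properties using (++⁺)
open import Data.List.Relation.Unary.Any using (here; there)
open import Data.List.Relation.Unary.Linked using (Linked; []; [-]; _∷_; tail)
open import Data.List.Relation.Unary.Linked.Properties using (Linked⇒All)
open import Data.List.Relation.Unary.Sorted.TotalOrder ≤-totalOrder using (Sorted)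
open import Data.List.Relation.Unary.Sorted.TotalOrder.Properties using (↗↭↗⇒≋)
open import Data.List.Relation.Binary.Equality.Propositional using (≋⇒≡)
open import Data.List.Relation.Binary.Permutation.Propositional
  using (_↭_; ↭-refl; ↭-sym; ↭-trans; ↭⇒↭ₛ)
open import Data.List.Relation.Binary.Permutation.Propositional.Properties
  using (∷↭∷ʳ; All-resp-↭)
open import Data.List.Sort ≤-decTotalOrder using (sort; sort-↭; sort-↗)
open import Data.Nat.ListAction.Properties using (sum-↭)
open import Data.Product using (∃; _×_; _,_; proj₁)
open import Function using (flip)
open import Relation.Binary.Core using (Rel)
open import Relation.Binary.Definitions using (Transitive)
open import Relation.Binary.PropositionalEquality using (_≡_; refl; sym; trans; cong; subst)
open Relation.Binary.PropositionalEquality.≡-Reasoning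

module _ {a ℓ} {A : Set a} {R : Rel A ℓ} where

  ∷ʳ-linked⁺ : ∀ {xs y} → Linked R xs → All (flip R y) xs → Linked R (xs ∷ʳ y)
  ∷ʳ-linked⁺ []             []             = [-]
  ∷ʳ-linked⁺ [-]            (xRy ∷ [])     = xRy ∷ [-]
  ∷ʳ-linked⁺ (xRx′ ∷ xs↗)  (_ ∷ x′Ry ∷ ps) = xRx′ ∷ ∷ʳ-linked⁺ xs↗ (x′Ry ∷ ps)

  ∷ʳ-linked⁻ : Transitive R → ∀ xs {y} → Linked R (xs ∷ʳ y) → Linked R xs × All (flip R y) xs
  ∷ʳ-linked⁻ R-trans []            _            = [] , []
  ∷ʳ-linked⁻ R-trans (x ∷ [])      (xRy ∷ _)    = [-] , xRy ∷ []
  ∷ʳ-linked⁻ R-trans (x ∷ x′ ∷ xs) (xRx′ ∷ xs↗) with ∷ʳ-linked⁻ R-trans (x′ ∷ xs) xs↗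
  ... | xs↗′ , ps@(x′Ry ∷ _) = xRx′ ∷ xs↗′ , R-trans xRx′ x′Ry ∷ ps

All-lastOf : ∀ {P : ℕ → Set} {x xs} → All P (x ∷ xs) → P (lastOf x xs)
All-lastOf {xs = []}     (px ∷ [])  = px
All-lastOf {xs = _ ∷ _}  (_ ∷ pxs) = All-lastOf pxs

sorted-≤-lastOf : ∀ {x xs} → Sorted (x ∷ xs) → All (_≤ lastOf x xs) (x ∷ xs)
sorted-≤-lastOf {xs = []}     _            = ≤-refl ∷ []
sorted-≤-lastOf {xs = _ ∷ _}  (x≤y ∷ ys↗) with sorted-≤-lastOf ys↗
... | ps@(y≤ ∷ _) = ≤-trans x≤y y≤ ∷ ps

∷-sorted : ∀ {x xs} → All (x ≤_) xs → Sorted xs → Sorted (x ∷ xs)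
∷-sorted []          _   = [-]
∷-sorted (x≤y ∷ _)  ys↗ = x≤y ∷ ys↗

sorted-head≤ : ∀ {x xs} → Sorted (x ∷ xs) → All (x ≤_) xs
sorted-head≤ [-]           = []
sorted-head≤ (x≤y ∷ ys↗) = Linked⇒All ≤-trans x≤y ys↗

sorted-↭⇒≡ : ∀ {xs ys} → Sorted xs → Sorted ys → xs ↭ ys → xs ≡ ys
sorted-↭⇒≡ xs↗ ys↗ p = ≋⇒≡ (↗↭↗⇒≋ ≤-totalOrder xs↗ ys↗ (↭⇒↭ₛ p))

rotate : List ℕ → List ℕ
rotate []       = []
rotate (x ∷ xs) = xs ∷ʳ x

↭-rotate : ∀ t → t ↭ rotate t
↭-rotate []       = ↭-refl
↭-rotate (x ∷ xs) = ∷↭∷ʳ x xs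

rotate-injective : ∀ {t u} → rotate t ≡ rotate u → t ≡ u
rotate-injective {[]}     {[]}          _  = refl
rotate-injective {[]}     {_ ∷ []}      ()
rotate-injective {[]}     {_ ∷ _ ∷ _}   ()
rotate-injective {_ ∷ []}    {[]}       ()
rotate-injective {_ ∷ _ ∷ _} {[]}       ()
rotate-injective {x ∷ xs} {y ∷ ys} eq with ∷ʳ-injective xs ys eq
... | refl , refl = refl

JumpSeq-preserves : ∀ {P : List ℕ → Set} → (∀ {r t u} → Jump r t u → P t → P u) →
                    ∀ {rs t u} → JumpSeq rs t u → P t → P u
JumpSeq-preserves keep done        pt = pt
JumpSeq-preserves keep (step j js) pt = JumpSeq-preserves keep js (keep j pt)

Jump-preserves-positive : ∀ {r t u} → Jump r t u → All (1 ≤_) t → All (1 ≤_) u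
Jump-preserves-positive (jump a as 1≤r r<a _ _) (_ ∷ as⁺) = m<n⇒0<n∸m r<a ∷ 1≤r ∷ as⁺

Jump-preserves-sum : ∀ {r t u} → Jump r t u → sum u ≡ sum t
Jump-preserves-sum {r} (jump a as _ r<a _ _) = begin
  a ∸ r + (r + sum as) ≡⟨ +-assoc (a ∸ r) r (sum as) ⟨
  a ∸ r + r + sum as   ≡⟨ cong (_+ sum as) (m∸n+n≡m (<⇒≤ r<a)) ⟩
  a + sum as           ∎

Jump-preserves-sorted-rotate : ∀ {r t u} → Jump r t u → Sorted (rotate t) → Sorted (rotate u)
Jump-preserves-sorted-rotate (jump a as _ _ r≤as last≤a∸r) as∷ʳa↗ =
  ∷ʳ-linked⁺ r∷as↗ (All.map (λ x≤last → ≤-trans x≤last last≤a∸r) (sorted-≤-lastOf r∷as↗))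
  where
  r∷as↗ : Sorted (_ ∷ as)
  r∷as↗ = ∷-sorted r≤as (proj₁ (∷ʳ-linked⁻ ≤-trans as as∷ʳa↗))

InR-partition : ∀ {n t} → 1 ≤ n → InR n t → All (1 ≤_) t × sum t ≡ n
InR-partition {n} 1≤n (_ , _ , js) =
  JumpSeq-preserves Jump-preserves-positive js (1≤n ∷ []) ,
  JumpSeq-preserves {P = λ t → sum t ≡ n} (λ j Σt≡n → trans (Jump-preserves-sum j) Σt≡n) js
    (+-identityʳ n)

InR-sorted-rotate : ∀ {n t} → InR n t → Sorted (rotate t)
InR-sorted-rotate (_ , _ , js) = JumpSeq-preserves Jump-preserves-sorted-rotate js [-]

InR-unique : ∀ {n t u} → InR n t → InR n u → t ↭ u → t ≡ u
InR-unique {t = t} {u} t∈R u∈R t↭u =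
  rotate-injective (sorted-↭⇒≡ (InR-sorted-rotate t∈R) (InR-sorted-rotate u∈R)
    (↭-trans (↭-sym (↭-rotate t)) (↭-trans t↭u (↭-rotate u))))

JumpSeq-∷ʳ : ∀ {rs r t u v} → JumpSeq rs t u → Jump r u v → JumpSeq (rs ∷ʳ r) t v
JumpSeq-∷ʳ done        j′ = step j′ done
JumpSeq-∷ʳ (step j js) j′ = step j (JumpSeq-∷ʳ js j′)

split-jump : ∀ {h r ts} → 1 ≤ h → 1 ≤ r → Sorted (r ∷ ts) → All (_≤ h) (r ∷ ts) →
             Jump r (h + r ∷ ts) (h ∷ r ∷ ts)
split-jump {h} {r} {ts} 1≤h 1≤r r∷ts↗ r∷ts≤h =
  subst (λ k → Jump r (h + r ∷ ts) (k ∷ r ∷ ts)) (m+n∸n≡m h r)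
    (jump (h + r) ts 1≤r (+-monoˡ-≤ r 1≤h) (sorted-head≤ r∷ts↗)
      (subst (lastOf r ts ≤_) (sym (m+n∸n≡m h r)) (All-lastOf r∷ts≤h)))

-- Recording that the orders are terms of ts is what keeps the sequence non-ascending
-- when the smaller term r is split off last.
split-off : ∀ h ts → 1 ≤ h → All (1 ≤_) ts → Sorted ts → All (_≤ h) ts →
  ∃ λ rs → NonAscending rs × All (_∈ ts) rs × JumpSeq rs [ h + sum ts ] (h ∷ ts)
split-off h [] _ _ _ _ =
  [] , [] , [] , subst (λ k → JumpSeq [] [ k ] [ h ]) (sym (+-identityʳ h)) done
split-off h (r ∷ ts) 1≤h (1≤r ∷ ts⁺) r∷ts↗ r∷ts≤h@(_ ∷ ts≤h)
  with split-off (h + r) ts 1≤h+r ts⁺ (tail r∷ts↗)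
                 (All.map (λ x≤h → ≤-trans x≤h (m≤m+n h r)) ts≤h)
  where 1≤h+r = ≤-trans 1≤h (m≤m+n h r)
... | rs , rs↘ , rs⊆ts , js =
  rs ∷ʳ r ,
  ∷ʳ-linked⁺ rs↘ (All.map (All.lookup (sorted-head≤ r∷ts↗)) rs⊆ts) ,
  ++⁺ (All.map there rs⊆ts) (here refl ∷ []) ,
  subst (λ k → JumpSeq (rs ∷ʳ r) [ k ] (h ∷ r ∷ ts)) (+-assoc h r (sum ts))
    (JumpSeq-∷ʳ js (split-jump 1≤h 1≤r r∷ts↗ r∷ts≤h))

sorted-represented : ∀ q → Sorted q → All (1 ≤_) q → 1 ≤ sum q →
                     ∃ λ t → InR (sum q) t × t ↭ q
sorted-represented q q↗ q⁺ 1≤Σq with initLast q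
-- the case q = [] is absurd, as 1≤Σq : 1 ≤ 0
... | ys ∷ʳ′ m with ∷ʳ-linked⁻ ≤-trans ys q↗ | All-resp-↭ (↭-sym (∷↭∷ʳ m ys)) q⁺
...   | ys↗ , ys≤m | 1≤m ∷ ys⁺ with split-off m ys 1≤m ys⁺ ys↗ ys≤m
...     | rs , rs↘ , _ , js =
  m ∷ ys , (rs , rs↘ , subst (λ k → JumpSeq rs [ k ] (m ∷ ys)) (sum-↭ (∷↭∷ʳ m ys)) js) ,
  ∷↭∷ʳ m ys

partition-represented : ∀ {n} p → 1 ≤ n → All (1 ≤_) p → sum p ≡ n →
                        ∃ λ t → InR n t × t ↭ p
partition-represented {n} p 1≤n p⁺ Σp≡n =
  let t , t∈R , t↭sort = sorted-represented (sort p) (sort-↗ p)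
                           (All-resp-↭ (↭-sym (sort-↭ p)) p⁺) (subst (1 ≤_) (sym Σsort≡n) 1≤n)
  in t , subst (λ k → InR k t) Σsort≡n t∈R , ↭-trans t↭sort (sort-↭ p)
  where
  Σsort≡n : sum (sort p) ≡ n
  Σsort≡n = trans (sum-↭ (sort-↭ p)) Σp≡n

mainTheorem3 : (n : ℕ) → 1 ≤ n →
    (∀ t → InR n t → All (1 ≤_) t × sum t ≡ n)
    × (∀ p → All (1 ≤_) p → sum p ≡ n → ∃ λ t → InR n t × t ↭ p)
    × (∀ t u → InR n t → InR n u → t ↭ u → t ≡ u)
mainTheorem3 n 1≤n =
  (λ _ → InR-partition 1≤n) ,
  (λ p → partition-represented p 1≤n) ,
  (λ _ _ → InR-unique)
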